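{- Let $G$ be a (not necessarily commutative) preordered group, $\vdash$ a regular entailment relation for $G$, and $V$ the distributive lattice it generates, with order $\leqslant_V$. Then $xa\wedge by\leqslant_V xb\vee ay$ for all $a,b\in V$ and all $x,y\in G$.
   Context: $G$ is a group (written multiplicatively) with a preorder $\leqslant$ such that $a\leqslant b$ implies $xay\leqslant xby$. $A,B,A',B'$ denote nonempty finite subsets of $G$; $a$ stands for $\{a\}$, commas denote unions, $xAy=\{xay:a\in A\}$. A regular entailment relation for $G$ is a relation $A\vdash B$ between nonempty finite subsets such that: (R1) $A\vdash B$ if $A\supseteq A'$, $B\supseteq B'$ and $A'\vdash B'$; (R2) $A\vdash B$ if $A,x\vdash B$ and $A\vdash B,x$; (R3) $a\vdash b$ if $a\leqslant b$; (R4) $A\vdash B$ if $xAy\vdash xBy$; (R5) $xa,by\vdash xb,ay$ for all $a,b,x,y\in G$. The distributive lattice $V$ generated by $\vdash$ is presented by generators $a\in G$ and relations $\bigwedge A\leqslant\bigvee B$ for $A\vdash B$; by (R4), left and right multiplication by elements of $G$ extend to lattice automorphisms of $V$, which give the meaning of $xa$ and $ay$ for $a\in V$. -}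

module Defs where

open import Level using (Level; _⊔_; suc)
open import Algebra.Bundles using (Group)
open import Relation.Binary.Core using (Rel)
open import Relation.Binary.Structures using (IsPreorder)
open import Data.List using (List; _∷_; [])
open import Data.List.NonEmpty as L⁺ using (List⁺; _∷⁺_; toList; foldr₁)
  renaming (map to map⁺)
import Data.List.Membership.Setoid as Mem

record PreorderedGroup (c ℓ p : Level) : Set (suc (c ⊔ ℓ ⊔ p)) where
  field
    group : Group c ℓ
  open Group group public
  infix 4 _≤_
  field
    _≤_        : Rel Carrier p
    isPreorder : IsPreorder _≈_ _≤_
    compat     : ∀ {a b} x y → a ≤ b → (x ∙ a) ∙ y ≤ (x ∙ b) ∙ y

module _ {c ℓ p} (PG : PreorderedGroup c ℓ p) where
  open PreorderedGroup PG
  open Mem setoid using (_∈_)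

  -- Nonempty finite subsets of G are represented by nonempty lists;
  -- inclusion is membership up to the group's equality.
  _⊆⁺_ : List⁺ Carrier → List⁺ Carrier → Set (c ⊔ ℓ)
  A' ⊆⁺ A = ∀ {z} → z ∈ toList A' → z ∈ toList A

  _·_·_ : Carrier → List⁺ Carrier → Carrier → List⁺ Carrier
  x · A · y = map⁺ (λ a → (x ∙ a) ∙ y) A

  -- Regular entailment relation (R1)-(R5).  "A , x" is  x ∷⁺ A.
  record IsRegularEntailment {e} (_⊢_ : List⁺ Carrier → List⁺ Carrier → Set e)
         : Set (c ⊔ ℓ ⊔ p ⊔ e) where
    field
      R1 : ∀ {A B A' B'} → A' ⊆⁺ A → B' ⊆⁺ B → A' ⊢ B' → A ⊢ B
      R2 : ∀ {A B} x → (x ∷⁺ A) ⊢ B → A ⊢ (x ∷⁺ B) → A ⊢ B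
      R3 : ∀ {a b} → a ≤ b → (a L⁺.∷ []) ⊢ (b L⁺.∷ [])
      R4 : ∀ {A B} x y → (x · A · y) ⊢ (x · B · y) → A ⊢ B
      R5 : ∀ a b x y → ((x ∙ a) L⁺.∷ (b ∙ y) ∷ []) ⊢ ((x ∙ b) L⁺.∷ (a ∙ y) ∷ [])

  data Term : Set c where
    gen  : Carrier → Term
    _∧_  : Term → Term → Term
    _∨_  : Term → Term → Term

  ⋀ ⋁ : List⁺ Carrier → Term
  ⋀ A = foldr₁ _∧_ (map⁺ gen A)
  ⋁ A = foldr₁ _∨_ (map⁺ gen A)

  -- The order ≤V of the distributive lattice V presented by generators
  -- a ∈ G and relations ⋀A ≤ ⋁B for A ⊢ B: the least preorder on terms
  -- satisfying the lattice and distributivity laws and these relations.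
  -- Elements of V are terms, equality in V is ≤V in both directions.
  module Generated {e} (_⊢_ : List⁺ Carrier → List⁺ Carrier → Set e) where
    infix 4 _≤V_
    data _≤V_ : Term → Term → Set (c ⊔ ℓ ⊔ p ⊔ e) where
      ≤-refl  : ∀ {t} → t ≤V t
      ≤-trans : ∀ {t u w} → t ≤V u → u ≤V w → t ≤V w
      ∧-lb₁   : ∀ {t u} → (t ∧ u) ≤V t
      ∧-lb₂   : ∀ {t u} → (t ∧ u) ≤V u
      ∧-glb   : ∀ {t u w} → t ≤V u → t ≤V w → t ≤V (u ∧ w)
      ∨-ub₁   : ∀ {t u} → t ≤V (t ∨ u)
      ∨-ub₂   : ∀ {t u} → u ≤V (t ∨ u)
      ∨-lub   : ∀ {t u w} → t ≤V w → u ≤V w → (t ∨ u) ≤V w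
      distrib : ∀ {t u w} → (t ∧ (u ∨ w)) ≤V ((t ∧ u) ∨ (t ∧ w))
      rel     : ∀ {A B} → A ⊢ B → ⋀ A ≤V ⋁ B

  -- Left and right multiplication by x ∈ G, extended to V (the lattice
  -- endomorphism induced on generators; an automorphism of V by (R4)).
  _·ₗ_ : Carrier → Term → Term
  x ·ₗ gen a  = gen (x ∙ a)
  x ·ₗ (t ∧ u) = (x ·ₗ t) ∧ (x ·ₗ u)
  x ·ₗ (t ∨ u) = (x ·ₗ t) ∨ (x ·ₗ u)

  _·ᵣ_ : Term → Carrier → Term
  gen a   ·ᵣ y = gen (a ∙ y)
  (t ∧ u) ·ᵣ y = (t ·ᵣ y) ∧ (u ·ᵣ y)
  (t ∨ u) ·ᵣ y = (t ·ᵣ y) ∨ (u ·ᵣ y)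

module Submission where

open import Defs
open import Level using (_⊔_)
open import Data.List.NonEmpty using (List⁺)

-- Both sides of the inequality are lattice expressions in a and b, and
-- x ·ₗ_ and _·ᵣ y commute with ∧ and ∨ on the nose.  Distributivity therefore
-- splits the inequality for a compound a or b into the inequalities for its
-- parts, so by induction on a and then on b it reduces to generators a, b ∈ G,
-- where it is literally the relation given by (R5).

module LatticeLaws {c ℓ p e} (PG : PreorderedGroup c ℓ p)
    (_⊢_ : List⁺ (PreorderedGroup.Carrier PG) → List⁺ (PreorderedGroup.Carrier PG) → Set e)
    where
  open Generated PG _⊢_

  ∧-monotonic : ∀ {s t u w : Term PG} → s ≤V u → t ≤V w → (s ∧ t) ≤V (u ∧ w)
  ∧-monotonic s≤u t≤w = ∧-glb (≤-trans ∧-lb₁ s≤u) (≤-trans ∧-lb₂ t≤w)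

  ∨-monotonic : ∀ {s t u w : Term PG} → s ≤V u → t ≤V w → (s ∨ t) ≤V (u ∨ w)
  ∨-monotonic s≤u t≤w = ∨-lub (≤-trans s≤u ∨-ub₁) (≤-trans t≤w ∨-ub₂)

  ∧-comm : ∀ {s t : Term PG} → (s ∧ t) ≤V (t ∧ s)
  ∧-comm = ∧-glb ∧-lb₂ ∧-lb₁

  ∨-comm : ∀ {s t : Term PG} → (s ∨ t) ≤V (t ∨ s)
  ∨-comm = ∨-lub ∨-ub₂ ∨-ub₁

  ∧-distribʳ-∨ : ∀ {s t u : Term PG} → ((s ∨ t) ∧ u) ≤V ((s ∧ u) ∨ (t ∧ u))
  ∧-distribʳ-∨ = ≤-trans ∧-comm (≤-trans distrib (∨-monotonic ∧-comm ∧-comm))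

  ∨-distribˡ-∧ : ∀ {s t u : Term PG} → ((s ∨ t) ∧ (s ∨ u)) ≤V (s ∨ (t ∧ u))
  ∨-distribˡ-∧ = ≤-trans distrib
    (∨-lub (≤-trans ∧-lb₂ ∨-ub₁)
           (≤-trans ∧-distribʳ-∨ (∨-lub (≤-trans ∧-lb₁ ∨-ub₁) ∨-ub₂)))

  ∨-distribʳ-∧ : ∀ {s t u : Term PG} → ((t ∨ s) ∧ (u ∨ s)) ≤V ((t ∧ u) ∨ s)
  ∨-distribʳ-∧ = ≤-trans (∧-monotonic ∨-comm ∨-comm) (≤-trans ∨-distribˡ-∧ ∨-comm)

  ∧-distribˡ-∧ : ∀ {s t u : Term PG} → (s ∧ (t ∧ u)) ≤V ((s ∧ t) ∧ (s ∧ u))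
  ∧-distribˡ-∧ = ∧-glb (∧-monotonic ≤-refl ∧-lb₁) (∧-monotonic ≤-refl ∧-lb₂)

  ∧-distribʳ-∧ : ∀ {s t u : Term PG} → ((s ∧ t) ∧ u) ≤V ((s ∧ u) ∧ (t ∧ u))
  ∧-distribʳ-∧ = ∧-glb (∧-monotonic ∧-lb₁ ≤-refl) (∧-monotonic ∧-lb₂ ≤-refl)

  ∨-distribˡ-∨ : ∀ {s t u : Term PG} → ((s ∨ t) ∨ (s ∨ u)) ≤V (s ∨ (t ∨ u))
  ∨-distribˡ-∨ = ∨-lub (∨-monotonic ≤-refl ∨-ub₁) (∨-monotonic ≤-refl ∨-ub₂)

  ∨-distribʳ-∨ : ∀ {s t u : Term PG} → ((t ∨ s) ∨ (u ∨ s)) ≤V ((t ∨ u) ∨ s)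
  ∨-distribʳ-∨ = ∨-lub (∨-monotonic ∨-ub₁ ≤-refl) (∨-monotonic ∨-ub₂ ≤-refl)

module _ {c ℓ p e} (PG : PreorderedGroup c ℓ p)
    (_⊢_ : List⁺ (PreorderedGroup.Carrier PG) → List⁺ (PreorderedGroup.Carrier PG) → Set e)
    where
  open PreorderedGroup PG using (Carrier; _∙_)
  open Generated PG _⊢_
  open LatticeLaws PG _⊢_

  SwapsGenerators : Set (c ⊔ ℓ ⊔ p ⊔ e)
  SwapsGenerators = ∀ a b x y → (gen (x ∙ a) ∧ gen (b ∙ y)) ≤V (gen (x ∙ b) ∨ gen (a ∙ y))

  swap-from-generators : SwapsGenerators → ∀ (a b : Term PG) (x y : Carrier)
    → (_·ₗ_ PG x a ∧ _·ᵣ_ PG b y) ≤V (_·ₗ_ PG x b ∨ _·ᵣ_ PG a y)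
  swap-from-generators swap (gen a) (gen b) x y = swap a b x y
  swap-from-generators swap (gen a) (b₁ ∧ b₂) x y = ≤-trans ∧-distribˡ-∧
    (≤-trans (∧-monotonic (swap-from-generators swap (gen a) b₁ x y)
                          (swap-from-generators swap (gen a) b₂ x y))
             ∨-distribʳ-∧)
  swap-from-generators swap (gen a) (b₁ ∨ b₂) x y = ≤-trans distrib
    (≤-trans (∨-monotonic (swap-from-generators swap (gen a) b₁ x y)
                          (swap-from-generators swap (gen a) b₂ x y))
             ∨-distribʳ-∨)
  swap-from-generators swap (a₁ ∧ a₂) b x y = ≤-trans ∧-distribʳ-∧
    (≤-trans (∧-monotonic (swap-from-generators swap a₁ b x y)
                          (swap-from-generators swap a₂ b x y))
             ∨-distribˡ-∧)
  swap-from-generators swap (a₁ ∨ a₂) b x y = ≤-trans ∧-distribʳ-∨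
    (≤-trans (∨-monotonic (swap-from-generators swap a₁ b x y)
                          (swap-from-generators swap a₂ b x y))
             ∨-distribˡ-∨)

lemma7p1 : ∀ {c ℓ p e} (PG : PreorderedGroup c ℓ p)
    (_⊢_ : List⁺ (PreorderedGroup.Carrier PG) → List⁺ (PreorderedGroup.Carrier PG) → Set e)
    → IsRegularEntailment PG _⊢_
    → ∀ (a b : Term PG) (x y : PreorderedGroup.Carrier PG)
    → Generated._≤V_ PG _⊢_ (_∧_ (_·ₗ_ PG x a) (_·ᵣ_ PG b y))
    (_∨_ (_·ₗ_ PG x b) (_·ᵣ_ PG a y))
lemma7p1 PG _⊢_ RE = swap-from-generators PG _⊢_ λ a b x y → Generated.rel (R5 a b x y)
  where open IsRegularEntailment RE
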